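{- Let $n>1$ be an integer and $d$ a positive proper divisor of $n$. Then $\chi(X_n(d)) = \omega(X_n(d)) = f\left(\frac{n}{d}\right)$.
   Context: For an integer $n>1$ and a set $D$ of positive proper divisors of $n$, the gcd-graph $X_n(D)$ has vertex set $\mathbb{Z}_n=\{0,1,\ldots,n-1\}$, and two distinct vertices $a,b$ are adjacent if and only if $\gcd(a-b,n)\in D$; $X_n(d)$ denotes $X_n(\{d\})$. For an integer $m>1$, $f(m)$ denotes the smallest prime divisor of $m$. $\chi$ is the chromatic number and $\omega$ the clique number. -}

module Defs where

open import Data.Nat using (ℕ; _≤_; _<_; ∣_-_∣; NonZero)
open import Data.Nat.GCD using (gcd)
open import Data.Nat.Divisibility using (_∣_)
open import Data.Nat.Primality using (Prime)
open import Data.Fin using (Fin; toℕ)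
open import Data.Product using (_×_; ∃)
open import Relation.Binary.PropositionalEquality using (_≡_; _≢_)
open import Relation.Nullary using (¬_)

-- The gcd-graph X_n(d) on vertex set Z_n = Fin n:
-- distinct a, b are adjacent iff gcd(a - b, n) = d.
-- For representatives 0 ≤ a, b < n, gcd((a - b) mod n, n) = gcd(|a - b|, n).
Adj : (n d : ℕ) → Fin n → Fin n → Set
Adj n d a b = (a ≢ b) × (gcd ∣ toℕ a - toℕ b ∣ n ≡ d)

ProperColouring : (n d k : ℕ) → Set
ProperColouring n d k =
  ∃ λ (c : Fin n → Fin k) → ∀ a b → Adj n d a b → c a ≢ c b

ChromaticNumber : (n d k : ℕ) → Set
ChromaticNumber n d k =
  ProperColouring n d k × (∀ j → j < k → ¬ ProperColouring n d j)

Clique : (n d k : ℕ) → Set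
Clique n d k =
  ∃ λ (v : Fin k → Fin n) → ∀ i j → i ≢ j → Adj n d (v i) (v j)

CliqueNumber : (n d k : ℕ) → Set
CliqueNumber n d k = Clique n d k × (∀ j → Clique n d j → j ≤ k)

SmallestPrimeDivisor : (p m : ℕ) → Set
SmallestPrimeDivisor p m =
  Prime p × p ∣ m × (∀ q → Prime q → q ∣ m → p ≤ q)

-- Write n = m d and let p be the least prime factor of m.  Every difference of two of the
-- multiples 0, d, …, (p−1)d is k d with 0 < k < p, so k is coprime to m and
-- gcd(k d, m d) = d: these p vertices form a clique.  Conversely, colouring a by
-- ⌊a/d⌋ mod p is proper: an edge ab has a − b = k d with k coprime to m, and equal
-- colours would force p ∣ k.  Since any clique is at most as large as any colouring,
-- both numbers equal p.
module Submission where

open import Defs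
open import Data.Nat using (ℕ; _≤_; _<_; _/_; NonZero)
open import Data.Nat.Divisibility using (_∣_)
open import Data.Product using (_×_; ∃)

open import Data.Nat.Base
  using (zero; suc; _+_; _*_; _∸_; ∣_-_∣; _%_; NonTrivial; n>1⇒nonTrivial; >-nonZero; ≢-nonZero; ≢-nonZero⁻¹)
open import Data.Nat.Properties
open import Data.Nat.Divisibility
  using (divides; _∣?_; ∣-refl; ∣⇒≤; 0∣⇒≡0; ∣m+n∣m⇒∣n; n∣m*n; quotient>1; n/m≡quotient)
open import Data.Nat.DivMod using (m≡m%n+[m/n]*n; m%n<n; m/n*n≡m; +-distrib-/-∣ʳ; m*n/n≡m)
open import Data.Nat.GCD using (gcd; gcd[m,n]∣m; c*gcd[m,n]≡gcd[cm,cn])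
open import Data.Nat.Coprimality using (Coprime; coprime⇒gcd≡1; gcd≡1⇒coprime)
open import Data.Nat.Primality
  using (Prime; _Rough_; 2-rough; rough⇒≤; ∤⇒rough-suc; rough∧∣⇒prime; prime⇒nonTrivial)
open import Data.Nat.Divisibility.Core using (hasNonTrivialDivisor)
open import Data.Fin using (Fin; toℕ; fromℕ<)
open import Data.Fin.Properties
  using (toℕ<n; toℕ-fromℕ<; fromℕ<-injective; toℕ-injective; pigeonhole) renaming (<⇒≢ to <⇒≢ᶠ)
open import Data.Product using (_,_)
open import Data.Sum using (inj₁; inj₂)
open import Data.Empty using (⊥-elim)
open import Function using (_∘_)
open import Relation.Nullary using (yes; no; contradiction)
open import Relation.Binary.PropositionalEquality

roughDivisor-from : ∀ m fuel k → fuel + k ≡ m → 2 ≤ k → k Rough m →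
                    ∃ λ p → 2 ≤ p × p ∣ m × p Rough m
roughDivisor-from m zero    k refl 2≤k rough = k , 2≤k , ∣-refl , rough
roughDivisor-from m (suc f) k eq   2≤k rough with k ∣? m
... | yes k∣m = k , 2≤k , k∣m , rough
... | no  k∤m = roughDivisor-from m f (suc k) (trans (+-suc f k) eq)
                  (≤-trans 2≤k (n≤1+n k)) (∤⇒rough-suc k∤m rough)

roughDivisor : ∀ m → 2 ≤ m → ∃ λ p → 2 ≤ p × p ∣ m × p Rough m
roughDivisor m 2≤m = roughDivisor-from m (m ∸ 2) 2 (m∸n+n≡m 2≤m) ≤-refl 2-rough

rough∧∣⇒smallestPrimeDivisor : ∀ {p m} → 2 ≤ p → p Rough m → p ∣ m → SmallestPrimeDivisor p m
rough∧∣⇒smallestPrimeDivisor {p} {m} 2≤p rough p∣m =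
  rough∧∣⇒prime {{n>1⇒nonTrivial 2≤p}} rough p∣m , p∣m , least
  where
  least : ∀ q → Prime q → q ∣ m → p ≤ q
  least q q-prime q∣m = ≮⇒≥ λ q<p →
    rough (hasNonTrivialDivisor {{prime⇒nonTrivial q-prime}} q<p q∣m)

rough⇒coprime : ∀ {p m k} → p Rough m → .{{NonZero k}} → k < p → Coprime k m
rough⇒coprime {k = k} rough k<p {zero}        (0∣k , _)   = contradiction (0∣⇒≡0 0∣k) (≢-nonZero⁻¹ k)
rough⇒coprime         rough k<p {suc zero}    _           = refl
rough⇒coprime         rough k<p {suc (suc i)} (i∣k , i∣m) =
  ⊥-elim (rough (hasNonTrivialDivisor (≤-<-trans (∣⇒≤ i∣k) k<p) i∣m))

gcd[mc,nc]≡gcd[m,n]*c : ∀ m n c → gcd (m * c) (n * c) ≡ gcd m n * c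
gcd[mc,nc]≡gcd[m,n]*c m n c = begin
  gcd (m * c) (n * c) ≡⟨ cong₂ gcd (*-comm m c) (*-comm n c) ⟩
  gcd (c * m) (c * n) ≡⟨ c*gcd[m,n]≡gcd[cm,cn] c m n ⟨
  c * gcd m n         ≡⟨ *-comm c (gcd m n) ⟩
  gcd m n * c         ∎
  where open ≡-Reasoning

gcd[mc,nc]≡c⇒coprime : ∀ m n c .{{_ : NonZero c}} → gcd (m * c) (n * c) ≡ c → Coprime m n
gcd[mc,nc]≡c⇒coprime m n c eq = gcd≡1⇒coprime (*-cancelʳ-≡ (gcd m n) 1 c (begin
  gcd m n * c         ≡⟨ gcd[mc,nc]≡gcd[m,n]*c m n c ⟨
  gcd (m * c) (n * c) ≡⟨ eq ⟩
  c                   ≡⟨ *-identityˡ c ⟨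
  1 * c               ∎))
  where open ≡-Reasoning

[m+n]%o≡m%o⇒o∣n : ∀ m n o .{{_ : NonZero o}} → (m + n) % o ≡ m % o → o ∣ n
[m+n]%o≡m%o⇒o∣n m n o eq =
  ∣m+n∣m⇒∣n (subst (o ∣_) (sym quotients) (n∣m*n ((m + n) / o))) (n∣m*n (m / o))
  where
  open ≡-Reasoning
  quotients : m / o * o + n ≡ (m + n) / o * o
  quotients = +-cancelˡ-≡ (m % o) _ _ (begin
    m % o + (m / o * o + n)       ≡⟨ +-assoc (m % o) _ n ⟨
    m % o + m / o * o + n         ≡⟨ cong (_+ n) (m≡m%n+[m/n]*n m o) ⟨
    m + n                         ≡⟨ m≡m%n+[m/n]*n (m + n) o ⟩
    (m + n) % o + (m + n) / o * o ≡⟨ cong (_+ (m + n) / o * o) eq ⟩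
    m % o + (m + n) / o * o       ∎)

multiplesClique : ∀ {n d m p} .{{_ : NonZero d}} → n ≡ m * d → p ≤ m → p Rough m → Clique n d p
multiplesClique {n} {d} {m} {p} n≡md p≤m rough = vertex , adjacent
  where
  vertex<n : (i : Fin p) → toℕ i * d < n
  vertex<n i = subst (toℕ i * d <_) (sym n≡md) (*-monoˡ-< d (<-≤-trans (toℕ<n i) p≤m))

  vertex : Fin p → Fin n
  vertex i = fromℕ< (vertex<n i)

  toℕ-vertex : ∀ i → toℕ (vertex i) ≡ toℕ i * d
  toℕ-vertex i = toℕ-fromℕ< (vertex<n i)

  adjacent : ∀ i j → i ≢ j → Adj n d (vertex i) (vertex j)
  adjacent i j i≢j = distinct , gcd≡d
    where
    open ≡-Reasoning
    k = ∣ toℕ i - toℕ j ∣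

    instance
      k≢0 : NonZero k
      k≢0 = ≢-nonZero (i≢j ∘ toℕ-injective ∘ ∣m-n∣≡0⇒m≡n)

    distinct : vertex i ≢ vertex j
    distinct eq = i≢j (toℕ-injective (*-cancelʳ-≡ (toℕ i) (toℕ j) d (begin
      toℕ i * d        ≡⟨ toℕ-vertex i ⟨
      toℕ (vertex i)   ≡⟨ cong toℕ eq ⟩
      toℕ (vertex j)   ≡⟨ toℕ-vertex j ⟩
      toℕ j * d        ∎)))

    k<p : k < p
    k<p = ≤-<-trans (∣m-n∣≤m⊔n (toℕ i) (toℕ j)) (⊔-pres-<m (toℕ<n i) (toℕ<n j))

    gcd≡d : gcd ∣ toℕ (vertex i) - toℕ (vertex j) ∣ n ≡ d
    gcd≡d = begin
      gcd ∣ toℕ (vertex i) - toℕ (vertex j) ∣ n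
        ≡⟨ cong₂ (λ a b → gcd ∣ a - b ∣ n) (toℕ-vertex i) (toℕ-vertex j) ⟩
      gcd ∣ toℕ i * d - toℕ j * d ∣ n
        ≡⟨ cong₂ gcd (sym (*-distribʳ-∣-∣ d (toℕ i) (toℕ j))) n≡md ⟩
      gcd (k * d) (m * d)   ≡⟨ gcd[mc,nc]≡gcd[m,n]*c k m d ⟩
      gcd k m * d           ≡⟨ cong (_* d) (coprime⇒gcd≡1 (rough⇒coprime rough k<p)) ⟩
      1 * d                 ≡⟨ *-identityˡ d ⟩
      d                     ∎

residueColouring : ∀ {n d m p} .{{_ : NonZero d}} → n ≡ m * d → 2 ≤ p → p ∣ m →
                   ProperColouring n d p
residueColouring {n} {d} {m} {p} n≡md 2≤p p∣m = colour , proper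
  where
  instance
    p≢0 : NonZero p
    p≢0 = >-nonZero (≤-trans (n≤1+n 1) 2≤p)

  colour : Fin n → Fin p
  colour a = fromℕ< (m%n<n (toℕ a / d) p)

  separated-≤ : ∀ {x y} → y ≤ x → gcd (x ∸ y) n ≡ d → (x / d) % p ≢ (y / d) % p
  separated-≤ {x} {y} y≤x gcd≡d sameResidue
    with divides k x∸y≡kd ← subst (_∣ x ∸ y) gcd≡d (gcd[m,n]∣m (x ∸ y) n) =
    <⇒≢ 2≤p (sym (coprime (p∣k , p∣m)))
    where
    coprime : Coprime k m
    coprime = gcd[mc,nc]≡c⇒coprime k m d (subst₂ (λ a b → gcd a b ≡ d) x∸y≡kd n≡md gcd≡d)

    x/d≡y/d+k : x / d ≡ y / d + k
    x/d≡y/d+k = begin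
      x / d             ≡⟨ cong (_/ d) (m+[n∸m]≡n y≤x) ⟨
      (y + (x ∸ y)) / d ≡⟨ cong (λ z → (y + z) / d) x∸y≡kd ⟩
      (y + k * d) / d   ≡⟨ +-distrib-/-∣ʳ y (n∣m*n k) ⟩
      y / d + k * d / d ≡⟨ cong (y / d +_) (m*n/n≡m k d) ⟩
      y / d + k         ∎
      where open ≡-Reasoning

    p∣k : p ∣ k
    p∣k = [m+n]%o≡m%o⇒o∣n (y / d) k p (trans (cong (_% p) (sym x/d≡y/d+k)) sameResidue)

  separated : ∀ x y → gcd ∣ x - y ∣ n ≡ d → (x / d) % p ≢ (y / d) % p
  separated x y gcd≡d with ≤-total y x
  ... | inj₁ y≤x = separated-≤ y≤x (subst (λ z → gcd z n ≡ d) (m≤n⇒∣n-m∣≡n∸m y≤x) gcd≡d)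
  ... | inj₂ x≤y = separated-≤ x≤y (subst (λ z → gcd z n ≡ d) (m≤n⇒∣m-n∣≡n∸m x≤y) gcd≡d) ∘ sym

  proper : ∀ a b → Adj n d a b → colour a ≢ colour b
  proper a b (_ , gcd≡d) = separated (toℕ a) (toℕ b) gcd≡d ∘ fromℕ<-injective _ _ _ _

clique≤colours : ∀ {n d j k} → Clique n d j → ProperColouring n d k → j ≤ k
clique≤colours (vertex , adjacent) (colour , proper) = ≮⇒≥ λ k<j →
  let i , i′ , i<i′ , sameColour = pigeonhole k<j (colour ∘ vertex)
  in proper (vertex i) (vertex i′) (adjacent i i′ (<⇒≢ᶠ i<i′)) sameColour

clique∧colouring⇒chromaticNumber∧cliqueNumber : ∀ {n d k} →
  Clique n d k → ProperColouring n d k → ChromaticNumber n d k × CliqueNumber n d k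
clique∧colouring⇒chromaticNumber∧cliqueNumber clique colouring =
    (colouring , λ j j<k colouring′ → <⇒≱ j<k (clique≤colours clique colouring′))
  , (clique , λ j clique′ → clique≤colours clique′ colouring)

-- The hypothesis 1 < n is redundant: it follows from 0 < d < n.
lemma2p4 : (n d : ℕ) → 1 < n → .{{_ : NonZero d}} → d ∣ n → d < n →
    ∃ λ p → SmallestPrimeDivisor p (n / d) × ChromaticNumber n d p × CliqueNumber n d p
lemma2p4 n d _ d∣n d<n =
  let p , 2≤p , p∣m , rough = roughDivisor (n / d) 2≤n/d
  in  p
    , rough∧∣⇒smallestPrimeDivisor 2≤p rough p∣m
    , clique∧colouring⇒chromaticNumber∧cliqueNumber
        (multiplesClique n≡[n/d]*d (rough⇒≤ rough) rough) (residueColouring n≡[n/d]*d 2≤p p∣m)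
  where
  n≡[n/d]*d : n ≡ n / d * d
  n≡[n/d]*d = sym (m/n*n≡m d∣n)

  2≤n/d : 2 ≤ n / d
  2≤n/d = subst (1 <_) (sym (n/m≡quotient d∣n)) (quotient>1 d∣n d<n)

  instance
    n/d-nonTrivial : NonTrivial (n / d)
    n/d-nonTrivial = n>1⇒nonTrivial 2≤n/d
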